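{- Let $k\ge1$, $n\ge k+2$, $w=n-k-2$. Take an equation $V_i=a_i^1V_{i-1}-\cdots+(-1)^{k-1}a_i^kV_{i-k}+(-1)^kV_{i-k-1}$ in $\mathcal{E}_{k+1,n}$, and let $(d'_{i,j})$ be the frieze associated (in the sense below, with $k$ and $w$ interchanged) with its Gale dual equation in $\mathcal{E}_{w+1,n}$. Then $d'_{i+1,k+i-j+1}=a_i^j$ for all $i\in\mathbb{Z}$ and $1\le j\le k$.
   Context: For $m\ge0$, $\mathcal{E}_{m+1,n}$ is the set of difference equations $V_i=a_i^1V_{i-1}-\cdots+(-1)^{m-1}a_i^mV_{i-m}+(-1)^mV_{i-m-1}$ with real $n$-periodic coefficients such that every solution satisfies $V_{i+n}=(-1)^mV_i$. The frieze associated with an equation of order $m+1$ (with $n-m-2=:u$) is the array $d_{i,j}:=V_j$ ($i-m-1\le j\le i+u+m$), where $(V_s)$ is the solution with $V_{i-m-1}=\dots=V_{i-2}=0$, $V_{i-1}=1$. The Gale dual of an equation in $\mathcal{E}_{k+1,n}$ with associated frieze $(d_{i,j})$ is $W_i=\alpha_i^1W_{i-1}-\alpha_i^2W_{i-2}+\cdots+(-1)^{w-1}\alpha_i^wW_{i-w}+(-1)^wW_{i-w-1}$ with $\alpha_i^j:=d_{i+1,w+i-j+1}$; it lies in $\mathcal{E}_{w+1,n}$. -}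

module Defs where

open import Level using (Level; _⊔_)
open import Algebra.Bundles using (CommutativeRing)
open import Data.Nat as ℕ using (ℕ; zero; suc; _≤_; _<_; _≤?_; _<?_)
open import Data.Integer as ℤ using (ℤ; +_; ∣_∣)
open import Data.List using (List; []; _∷_)
open import Data.Product using (∃; _×_)
open import Relation.Nullary using (¬_; yes; no)

IsField : ∀ {c ℓ} → CommutativeRing c ℓ → Set (c ⊔ ℓ)
IsField R = ¬ (1# ≈ 0#) × (∀ x → ¬ (x ≈ 0#) → ∃ λ y → x * y ≈ 1#)
  where open CommutativeRing R

module _ {c ℓ} (R : CommutativeRing c ℓ) where
  open CommutativeRing R

  -- Coefficients of an equation: a i j = a_i^j (only 1 ≤ j ≤ m is used).
  Coeffs : Set c
  Coeffs = ℤ → ℕ → Carrier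

  sgn : ℕ → Carrier
  sgn zero = 1#
  sgn (suc k) = - sgn k

  sum1 : ℕ → (ℕ → Carrier) → Carrier
  sum1 zero f = 0#
  sum1 (suc m) f = sum1 m f + f (suc m)

  rhs : (m : ℕ) → Coeffs → (ℤ → Carrier) → ℤ → Carrier
  rhs m a V i =
    sum1 m (λ j → sgn (j ℕ.∸ 1) * (a i j * V (i ℤ.- + j)))
      + sgn m * V (i ℤ.- + (suc m))

  IsSolution : (m : ℕ) → Coeffs → (ℤ → Carrier) → Set ℓ
  IsSolution m a V = ∀ i → V i ≈ rhs m a V i

  -- The equation with coefficients a (order m+1) lies in E_{m+1,n}:
  -- n-periodic coefficients and every solution satisfies V_{i+n} = (-1)^m V_i.
  InE : (m n : ℕ) → Coeffs → Set (c ⊔ ℓ)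
  InE m n a =
    (∀ i j → 1 ≤ j → j ≤ m → a (i ℤ.+ + n) j ≈ a i j)
    × (∀ V → IsSolution m a V → ∀ i → V (i ℤ.+ + n) ≈ sgn m * V i)

  nth : List Carrier → ℕ → Carrier
  nth [] _ = 0#
  nth (x ∷ xs) zero = x
  nth (x ∷ xs) (suc t) = nth xs t

  -- The solution with V_s = … = V_{s+m-1} = 0 (s = i-m-1), V_{s+m} = 1,
  -- computed forward. hist m a s t = [V_{s+t}, V_{s+t-1}, …, V_s].
  hist : (m : ℕ) → Coeffs → (s : ℤ) → ℕ → List Carrier
  hist m a s zero with 0 <? m
  ... | yes _ = 0# ∷ []
  ... | no  _ = 1# ∷ []
  hist m a s (suc t) with suc t ≤? m
  ... | yes _ with suc t <? m
  ...   | yes _ = 0# ∷ hist m a s t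
  ...   | no  _ = 1# ∷ hist m a s t
  hist m a s (suc t) | no _ =
    (sum1 m (λ j → sgn (j ℕ.∸ 1) * (a p j * nth h (j ℕ.∸ 1)))
      + sgn m * nth h m) ∷ h
    where
      h = hist m a s t
      p = s ℤ.+ + suc t

  solAt : (m : ℕ) → Coeffs → (s : ℤ) → ℕ → Carrier
  solAt m a s t = nth (hist m a s t) 0

  -- Frieze associated with the equation of order m+1:
  -- d_{i,j} = V_j where V is the solution with V_{i-m-1} = … = V_{i-2} = 0,
  -- V_{i-1} = 1. Meaningful for j ≥ i-m-1 (as in the paper, i-m-1 ≤ j ≤ i+u+m).
  frieze : (m : ℕ) → Coeffs → ℤ → ℤ → Carrier
  frieze m a i j = solAt m a s ∣ j ℤ.- s ∣
    where s = i ℤ.- + suc m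

  galeDual : (k w : ℕ) → Coeffs → Coeffs
  galeDual k w a i j = frieze k a (i ℤ.+ + 1) (+ w ℤ.+ i ℤ.- + j ℤ.+ + 1)

-- Fix i and put b = (a_i^1, …, a_i^k, 1, 0, 0, …). The entries d'_{i+1,·} of the
-- dual frieze are the values W_t of the solution of the dual equation with
-- W_0 = … = W_{w-1} = 0, W_w = 1 read from i - w on, and the claim becomes
-- W_t = b_{k+w+1-t} for t ≤ k + w. The right-hand side has the same initial values,
-- so it suffices that it satisfies the dual recurrence. The dual coefficients at a
-- position p are the values F_{k+w+1-j} of the solution F of the original equation
-- started at p - k. Solutions are n-antiperiodic (after continuing F backwards to
-- all of ℤ), so F_{n-1} = 1 and F_n = … = F_{n+k-1} = 0; together with
-- a_{i+n} = a_i this turns the original recurrence for F_{n+c} (c < k) into the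
-- dual recurrence for W_{k+w-c}.

module Submission where

open import Defs
open import Algebra.Bundles using (CommutativeRing)
open import Data.Nat as ℕ using (ℕ; zero; suc; _∸_; _≤_; _<_; z≤n; s≤s; _≤?_; _<?_)
import Data.Nat.Properties as ℕₚ
open import Data.Nat.Induction using (<-rec)
open import Data.Integer as ℤ using (ℤ; +_; -[1+_]; ∣_∣)
import Data.Integer.Properties as ℤₚ
import Data.Integer.Tactic.RingSolver as ℤ-Solver
import Data.Nat.Tactic.RingSolver as ℕ-Solver
open import Data.Product using (Σ-syntax; _×_; _,_; proj₁; proj₂)
open import Data.Sum using (inj₁; inj₂)
open import Relation.Binary.Definitions using (tri<; tri≈; tri>)
open import Relation.Nullary using (yes; no)
open import Relation.Nullary.Negation using (contradiction)
open import Relation.Binary.PropositionalEquality as ≡ using (_≡_; refl)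

[1+k+w]∸j<k : ∀ {k w j} → 0 < k → suc w < j → suc (k ℕ.+ w) ∸ j < k
[1+k+w]∸j<k {suc k} {w} {j} _ 1+w<j =
  s≤s (ℕₚ.≤-trans (ℕₚ.∸-monoʳ-≤ (suc (suc k ℕ.+ w)) 1+w<j) (ℕₚ.≤-reflexive (ℕₚ.m+n∸n≡m k w)))

[n+c]∸[c+j]≡n∸j : ∀ n c j → (n ℕ.+ c) ∸ (c ℕ.+ j) ≡ n ∸ j
[n+c]∸[c+j]≡n∸j n c j = ≡.trans (≡.cong (_∸ (c ℕ.+ j)) (ℕₚ.+-comm n c)) (ℕₚ.[m+n]∸[m+o]≡n∸o c n j)

[1+k+w]∸[[1+w+u]∸j]≡1+c+j : ∀ {k} w u c {j} → suc (u ℕ.+ c) ≡ k → j ≤ suc w →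
                               suc (k ℕ.+ w) ∸ (suc (w ℕ.+ u) ∸ j) ≡ suc c ℕ.+ j
[1+k+w]∸[[1+w+u]∸j]≡1+c+j w u c {j} refl j≤1+w = begin
  suc (suc (u ℕ.+ c) ℕ.+ w) ∸ (M ∸ j)   ≡⟨ ≡.cong (_∸ (M ∸ j)) (regroup w u c) ⟩
  suc c ℕ.+ M ∸ (M ∸ j)                 ≡⟨ ℕₚ.+-∸-assoc (suc c) (ℕₚ.m∸n≤m M j) ⟩
  suc c ℕ.+ (M ∸ (M ∸ j))               ≡⟨ ≡.cong (suc c ℕ.+_) (ℕₚ.m∸[m∸n]≡n (ℕₚ.≤-trans j≤1+w (s≤s (ℕₚ.m≤m+n w u)))) ⟩
  suc c ℕ.+ j                           ∎
  where
  open ≡.≡-Reasoning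
  M : ℕ
  M = suc (w ℕ.+ u)
  regroup : ∀ w u c → suc (suc (u ℕ.+ c) ℕ.+ w) ≡ suc c ℕ.+ suc (w ℕ.+ u)
  regroup = ℕ-Solver.solve-∀

+m-+n≡+[m∸n] : ∀ {m n} → n ≤ m → + m ℤ.- + n ≡ + (m ∸ n)
+m-+n≡+[m∸n] {m} {n} n≤m = ≡.trans (ℤₚ.m-n≡m⊖n m n) (ℤₚ.⊖-≥ n≤m)

x+m-n≡x+[m∸n] : ∀ x {m n} → n ≤ m → x ℤ.+ + m ℤ.- + n ≡ x ℤ.+ + (m ∸ n)
x+m-n≡x+[m∸n] x {m} {n} n≤m =
  ≡.trans (ℤₚ.+-assoc x (+ m) (ℤ.- + n)) (≡.cong (λ y → x ℤ.+ y) (+m-+n≡+[m∸n] n≤m))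

x-[1+d]+[1+q]≡x-d+q : ∀ x d q → x ℤ.- + suc d ℤ.+ + suc q ≡ x ℤ.- + d ℤ.+ + q
x-[1+d]+[1+q]≡x-d+q x d q =
  ≡.trans (≡.cong₂ (λ d′ q′ → x ℤ.- d′ ℤ.+ q′) (ℤₚ.pos-+ 1 d) (ℤₚ.pos-+ 1 q))
          (cancel x (+ d) (+ q))
  where
  cancel : ∀ x d q → x ℤ.- (+ 1 ℤ.+ d) ℤ.+ (+ 1 ℤ.+ q) ≡ x ℤ.- d ℤ.+ q
  cancel = ℤ-Solver.solve-∀

x+1-[1+m]≡x-m : ∀ x m → x ℤ.+ + 1 ℤ.- + suc m ≡ x ℤ.- + m
x+1-[1+m]≡x-m x m = ≡.trans (≡.cong (λ m′ → x ℤ.+ + 1 ℤ.- m′) (ℤₚ.pos-+ 1 m)) (cancel x (+ m))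
  where
  cancel : ∀ x m → x ℤ.+ + 1 ℤ.- (+ 1 ℤ.+ m) ≡ x ℤ.- m
  cancel = ℤ-Solver.solve-∀

w+x-j+1-[x-m]≡+[1+m+w∸j] : ∀ x m w {j} → j ≤ suc (m ℕ.+ w) →
  (+ w ℤ.+ x ℤ.- + j ℤ.+ + 1) ℤ.- (x ℤ.- + m) ≡ + (suc (m ℕ.+ w) ∸ j)
w+x-j+1-[x-m]≡+[1+m+w∸j] x m w {j} j≤ = begin
  (+ w ℤ.+ x ℤ.- + j ℤ.+ + 1) ℤ.- (x ℤ.- + m)   ≡⟨ reorder x (+ m) (+ w) (+ j) ⟩
  + 1 ℤ.+ (+ m ℤ.+ + w) ℤ.- + j                 ≡⟨ ≡.cong (λ y → + 1 ℤ.+ y ℤ.- + j) (ℤₚ.pos-+ m w) ⟨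
  + 1 ℤ.+ + (m ℕ.+ w) ℤ.- + j                   ≡⟨ ≡.cong (λ y → y ℤ.- + j) (ℤₚ.pos-+ 1 (m ℕ.+ w)) ⟨
  + suc (m ℕ.+ w) ℤ.- + j                       ≡⟨ +m-+n≡+[m∸n] j≤ ⟩
  + (suc (m ℕ.+ w) ∸ j)                         ∎
  where
  open ≡.≡-Reasoning
  reorder : ∀ x m w j → (w ℤ.+ x ℤ.- j ℤ.+ + 1) ℤ.- (x ℤ.- m) ≡ + 1 ℤ.+ (m ℤ.+ w) ℤ.- j
  reorder = ℤ-Solver.solve-∀

x-a+b-c+d≡x+e : ∀ x {a b c d e} → b ℕ.+ d ≡ a ℕ.+ c ℕ.+ e → x ℤ.- + a ℤ.+ + b ℤ.- + c ℤ.+ + d ≡ x ℤ.+ + e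
x-a+b-c+d≡x+e x {a} {b} {c} {d} {e} b+d≡a+c+e = begin
  x ℤ.- + a ℤ.+ + b ℤ.- + c ℤ.+ + d          ≡⟨ regroup x (+ a) (+ b) (+ c) (+ d) ⟩
  x ℤ.+ (+ b ℤ.+ + d) ℤ.- (+ a ℤ.+ + c)      ≡⟨ ≡.cong₂ (λ y z → x ℤ.+ y ℤ.- z) (ℤₚ.pos-+ b d) (ℤₚ.pos-+ a c) ⟨
  x ℤ.+ + (b ℕ.+ d) ℤ.- + (a ℕ.+ c)          ≡⟨ ≡.cong (λ y → x ℤ.+ + y ℤ.- + (a ℕ.+ c)) b+d≡a+c+e ⟩
  x ℤ.+ + (a ℕ.+ c ℕ.+ e) ℤ.- + (a ℕ.+ c)    ≡⟨ x+m-n≡x+[m∸n] x (ℕₚ.m≤m+n (a ℕ.+ c) e) ⟩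
  x ℤ.+ + (a ℕ.+ c ℕ.+ e ∸ (a ℕ.+ c))        ≡⟨ ≡.cong (λ y → x ℤ.+ + y) (ℕₚ.m+n∸m≡n (a ℕ.+ c) e) ⟩
  x ℤ.+ + e                                   ∎
  where
  open ≡.≡-Reasoning
  regroup : ∀ x a b c d → x ℤ.- a ℤ.+ b ℤ.- c ℤ.+ d ≡ x ℤ.+ (b ℤ.+ d) ℤ.- (a ℤ.+ c)
  regroup = ℤ-Solver.solve-∀

i-w+[1+w+u]-k+[2+k+w+c]≡i+[2+k+w] : ∀ i w {k} u c → suc (u ℕ.+ c) ≡ k →
  i ℤ.- + w ℤ.+ + suc (w ℕ.+ u) ℤ.- + k ℤ.+ + suc (suc (k ℕ.+ w) ℕ.+ c) ≡ i ℤ.+ + suc (suc (k ℕ.+ w))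
i-w+[1+w+u]-k+[2+k+w+c]≡i+[2+k+w] i w u c refl = x-a+b-c+d≡x+e i (count w u c)
  where
  count : ∀ w u c → suc (w ℕ.+ u) ℕ.+ suc (suc (suc (u ℕ.+ c) ℕ.+ w) ℕ.+ c)
                    ≡ w ℕ.+ suc (u ℕ.+ c) ℕ.+ suc (suc (suc (u ℕ.+ c) ℕ.+ w))
  count = ℕ-Solver.solve-∀

z≡s+[z-s] : ∀ z s → z ≡ s ℤ.+ (z ℤ.- s)
z≡s+[z-s] = ℤ-Solver.solve-∀

decompose-offset : ∀ m s z → Σ[ d ∈ ℕ ] Σ[ t ∈ ℕ ] m ≤ t × z ≡ s ℤ.- + d ℤ.+ + suc t
decompose-offset m s z with z ℤ.- s in z-s≡
... | + q = suc m , m ℕ.+ q , ℕₚ.m≤m+n m q , (begin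
  z                                      ≡⟨ z≡s+[z-s] z s ⟩
  s ℤ.+ (z ℤ.- s)                        ≡⟨ ≡.cong (λ y → s ℤ.+ y) z-s≡ ⟩
  s ℤ.+ + q                              ≡⟨ cancel s (+ m) (+ q) ⟩
  s ℤ.- + m ℤ.+ (+ m ℤ.+ + q)            ≡⟨ ≡.cong (λ y → s ℤ.- + m ℤ.+ y) (ℤₚ.pos-+ m q) ⟨
  s ℤ.- + m ℤ.+ + (m ℕ.+ q)              ≡⟨ x-[1+d]+[1+q]≡x-d+q s m (m ℕ.+ q) ⟨
  s ℤ.- + suc m ℤ.+ + suc (m ℕ.+ q)      ∎)
  where
  open ≡.≡-Reasoning
  cancel : ∀ s m q → s ℤ.+ q ≡ s ℤ.- m ℤ.+ (m ℤ.+ q)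
  cancel = ℤ-Solver.solve-∀
... | -[1+ q ] = suc q ℕ.+ suc m , m , ℕₚ.≤-refl , (begin
  z                                              ≡⟨ z≡s+[z-s] z s ⟩
  s ℤ.+ (z ℤ.- s)                                ≡⟨ ≡.cong (λ y → s ℤ.+ y) z-s≡ ⟩
  s ℤ.- + suc q                                  ≡⟨ cancel s (+ suc q) (+ suc m) ⟩
  s ℤ.- (+ suc q ℤ.+ + suc m) ℤ.+ + suc m        ≡⟨ ≡.cong (λ y → s ℤ.- y ℤ.+ + suc m) (ℤₚ.pos-+ (suc q) (suc m)) ⟨
  s ℤ.- + (suc q ℕ.+ suc m) ℤ.+ + suc m          ∎)
  where
  open ≡.≡-Reasoning
  cancel : ∀ s q m → s ℤ.- q ≡ s ℤ.- (q ℤ.+ m) ℤ.+ m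
  cancel = ℤ-Solver.solve-∀

module _ {c ℓ} (R : CommutativeRing c ℓ) where
  open CommutativeRing R renaming (refl to ≈-refl; sym to ≈-sym; trans to ≈-trans)
  open import Algebra.Properties.Ring ring using (-‿distribˡ-*; -‿distribʳ-*; -‿involutive; -0#≈0#; x∙y⁻¹≈ε⇒x≈y)
  open import Relation.Binary.Reasoning.Setoid setoid

  sgn-+ : ∀ p q → sgn R (p ℕ.+ q) ≈ sgn R p * sgn R q
  sgn-+ zero    q = ≈-sym (*-identityˡ _)
  sgn-+ (suc p) q = ≈-trans (-‿cong (sgn-+ p q)) (-‿distribˡ-* (sgn R p) (sgn R q))

  sgn*sgn≈1 : ∀ p → sgn R p * sgn R p ≈ 1#
  sgn*sgn≈1 zero    = *-identityˡ 1#
  sgn*sgn≈1 (suc p) = begin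
    - sgn R p * - sgn R p     ≈⟨ -‿distribˡ-* (sgn R p) (- sgn R p) ⟨
    - (sgn R p * - sgn R p)   ≈⟨ -‿cong (-‿distribʳ-* (sgn R p) (sgn R p)) ⟨
    - - (sgn R p * sgn R p)   ≈⟨ -‿involutive _ ⟩
    sgn R p * sgn R p         ≈⟨ sgn*sgn≈1 p ⟩
    1#                        ∎

  *-cancelˡ-involutive : ∀ {x y z} → x * x ≈ 1# → x * y ≈ x * z → y ≈ z
  *-cancelˡ-involutive {x} {y} {z} x²≈1 xy≈xz = begin
    y            ≈⟨ *-identityˡ y ⟨
    1# * y       ≈⟨ *-congʳ x²≈1 ⟨
    x * x * y    ≈⟨ *-assoc x x y ⟩
    x * (x * y)  ≈⟨ *-congˡ xy≈xz ⟩
    x * (x * z)  ≈⟨ *-assoc x x z ⟨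
    x * x * z    ≈⟨ *-congʳ x²≈1 ⟩
    1# * z       ≈⟨ *-identityˡ z ⟩
    z            ∎

  sum1-cong : ∀ m {f g : ℕ → Carrier} → (∀ j → 1 ≤ j → j ≤ m → f j ≈ g j) →
              sum1 R m f ≈ sum1 R m g
  sum1-cong zero    f≈g = ≈-refl
  sum1-cong (suc m) f≈g =
    +-cong (sum1-cong m (λ j 1≤j j≤m → f≈g j 1≤j (ℕₚ.m≤n⇒m≤1+n j≤m))) (f≈g (suc m) (s≤s z≤n) ℕₚ.≤-refl)

  sum1-≈0 : ∀ m {f : ℕ → Carrier} → (∀ j → 1 ≤ j → j ≤ m → f j ≈ 0#) → sum1 R m f ≈ 0#
  sum1-≈0 zero    f≈0 = ≈-refl
  sum1-≈0 (suc m) f≈0 = ≈-trans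
    (+-cong (sum1-≈0 m (λ j 1≤j j≤m → f≈0 j 1≤j (ℕₚ.m≤n⇒m≤1+n j≤m))) (f≈0 (suc m) (s≤s z≤n) ℕₚ.≤-refl))
    (+-identityˡ 0#)

  sum1-+ : ∀ p q (f : ℕ → Carrier) → sum1 R (p ℕ.+ q) f ≈ sum1 R p f + sum1 R q (λ j → f (p ℕ.+ j))
  sum1-+ p zero    f rewrite ℕₚ.+-identityʳ p = ≈-sym (+-identityʳ _)
  sum1-+ p (suc q) f rewrite ℕₚ.+-suc p q = begin
    sum1 R (p ℕ.+ q) f + f (suc (p ℕ.+ q))                                 ≈⟨ +-congʳ (sum1-+ p q f) ⟩
    sum1 R p f + sum1 R q (λ j → f (p ℕ.+ j)) + f (suc (p ℕ.+ q))          ≈⟨ +-assoc _ _ _ ⟩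
    sum1 R p f + (sum1 R q (λ j → f (p ℕ.+ j)) + f (suc (p ℕ.+ q)))        ∎

  sum1-*ˡ : ∀ m x (f : ℕ → Carrier) → sum1 R m (λ j → x * f j) ≈ x * sum1 R m f
  sum1-*ˡ zero    x f = ≈-sym (zeroʳ x)
  sum1-*ˡ (suc m) x f = ≈-trans (+-congʳ (sum1-*ˡ m x f)) (≈-sym (distribˡ x _ _))

  sum1-vanishing-tail : ∀ {L M} (f : ℕ → Carrier) → L ≤ M → (∀ j → L < j → j ≤ M → f j ≈ 0#) →
                        sum1 R M f ≈ sum1 R L f
  sum1-vanishing-tail {L} f L≤M tail with ℕₚ.m≤n⇒∃[o]m+o≡n L≤M
  ... | o , refl = begin
    sum1 R (L ℕ.+ o) f                          ≈⟨ sum1-+ L o f ⟩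
    sum1 R L f + sum1 R o (λ j → f (L ℕ.+ j))   ≈⟨ +-congˡ (sum1-≈0 o tail′) ⟩
    sum1 R L f + 0#                             ≈⟨ +-identityʳ _ ⟩
    sum1 R L f                                  ∎
    where
    tail′ : ∀ j → 1 ≤ j → j ≤ o → f (L ℕ.+ j) ≈ 0#
    tail′ j 1≤j j≤o = tail (L ℕ.+ j) (ℕₚ.m<m+n L 1≤j) (ℕₚ.+-monoʳ-≤ L j≤o)

  alternatingSum : ℕ → (ℕ → Carrier) → (ℕ → Carrier) → ℕ → Carrier
  alternatingSum m c Y q = sum1 R m (λ j → sgn R (j ∸ 1) * (c j * Y (q ∸ j)))

  -- The right-hand side of the equation at position s + t + 1, for a sequence
  -- read from s on: Y t stands for V (s + t).
  rhsFrom : ℕ → Coeffs R → ℤ → (ℕ → Carrier) → ℕ → Carrier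
  rhsFrom m a s Y t = alternatingSum m (a (s ℤ.+ + suc t)) Y (suc t) + sgn R m * Y (t ∸ m)

  rhsFrom-cong : ∀ m a s {Y Z : ℕ → Carrier} t → (∀ t′ → t′ ≤ t → Y t′ ≈ Z t′) →
                 rhsFrom m a s Y t ≈ rhsFrom m a s Z t
  rhsFrom-cong m a s t Y≈Z = +-cong
    (sum1-cong m (λ j 1≤j _ → *-congˡ (*-congˡ (Y≈Z (suc t ∸ j) (ℕₚ.∸-monoʳ-≤ (suc t) 1≤j)))))
    (*-congˡ (Y≈Z _ (ℕₚ.m∸n≤m t m)))

  rhs≈rhsFrom : ∀ m a x V (Y : ℕ → Carrier) t → m ≤ t → (∀ q → q ≤ suc t → V (x ℤ.+ + q) ≈ Y q) →
                rhs R m a V (x ℤ.+ + suc t) ≈ rhsFrom m a x Y t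
  rhs≈rhsFrom m a x V Y t m≤t V≈Y = +-cong
    (sum1-cong m (λ j _ j≤m → *-congˡ (*-congˡ (readAt (ℕₚ.≤-trans j≤m (ℕₚ.m≤n⇒m≤1+n m≤t))))))
    (*-congˡ (readAt (s≤s m≤t)))
    where
    readAt : ∀ {j} → j ≤ suc t → V (x ℤ.+ + suc t ℤ.- + j) ≈ Y (suc t ∸ j)
    readAt {j} j≤ = ≈-trans (reflexive (≡.cong V (x+m-n≡x+[m∸n] x j≤))) (V≈Y (suc t ∸ j) (ℕₚ.m∸n≤m (suc t) j))

  solAt-m≡1 : ∀ m a s → solAt R m a s m ≡ 1#
  solAt-m≡1 zero    a s = refl
  solAt-m≡1 (suc p) a s with suc p ≤? suc p
  ... | no p≰p = contradiction ℕₚ.≤-refl p≰p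
  ... | yes _ with suc p <? suc p
  ...   | yes p<p = contradiction p<p (ℕₚ.<-irrefl refl)
  ...   | no _    = refl

  module _ (m : ℕ) (a : Coeffs R) (s : ℤ) where

    private
      hist-suc : ∀ t r → nth R (hist R m a s (suc t)) (suc r) ≡ nth R (hist R m a s t) r
      hist-suc t r with suc t ≤? m
      ... | no _ = refl
      ... | yes _ with suc t <? m
      ...   | yes _ = refl
      ...   | no _  = refl

      nth-hist : ∀ t r → r ≤ t → nth R (hist R m a s t) r ≡ solAt R m a s (t ∸ r)
      nth-hist t       zero    _         = refl
      nth-hist (suc t) (suc r) (s≤s r≤t) = ≡.trans (hist-suc t r) (nth-hist t r r≤t)

    solAt-< : ∀ {t} → t < m → solAt R m a s t ≡ 0#
    solAt-< {zero} 0<m with 0 <? m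
    ... | yes _  = refl
    ... | no 0≮m = contradiction 0<m 0≮m
    solAt-< {suc t} t<m with suc t ≤? m
    ... | no t≰m = contradiction (ℕₚ.<⇒≤ t<m) t≰m
    ... | yes _ with suc t <? m
    ...   | yes _  = refl
    ...   | no t≮m = contradiction t<m t≮m

    solAt-suc : ∀ {t} → m ≤ t → solAt R m a s (suc t) ≈ rhsFrom m a s (solAt R m a s) t
    solAt-suc {t} m≤t with suc t ≤? m
    ... | yes t<m = contradiction (ℕₚ.≤-trans t<m m≤t) (ℕₚ.<-irrefl refl)
    ... | no _    = +-cong
      (sum1-cong m (λ { (suc j) _ j<m → *-congˡ (*-congˡ (reflexive (nth-hist t j (ℕₚ.≤-trans (ℕₚ.<⇒≤ j<m) m≤t)))) }))
      (*-congˡ (reflexive (nth-hist t m m≤t)))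

    solAt-unique : ∀ (Y : ℕ → Carrier) T → (∀ t → t < m → Y t ≈ 0#) → Y m ≈ 1# →
                   (∀ t → m ≤ t → t < T → Y (suc t) ≈ rhsFrom m a s Y t) →
                   ∀ t → t ≤ T → solAt R m a s t ≈ Y t
    solAt-unique Y T Y-< Y-m Y-suc = <-rec (λ t → t ≤ T → solAt R m a s t ≈ Y t) agree
      where
      agree : ∀ t → (∀ {t′} → t′ < t → t′ ≤ T → solAt R m a s t′ ≈ Y t′) → t ≤ T → solAt R m a s t ≈ Y t
      agree t ih t≤T with ℕₚ.<-cmp t m
      ... | tri< t<m _ _    = ≈-trans (reflexive (solAt-< t<m)) (≈-sym (Y-< t t<m))
      ... | tri≈ _ refl _   = ≈-trans (reflexive (solAt-m≡1 m a s)) (≈-sym Y-m)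
      agree (suc t) ih t<T | tri> _ _ (s≤s m≤t) = begin
        solAt R m a s (suc t)             ≈⟨ solAt-suc m≤t ⟩
        rhsFrom m a s (solAt R m a s) t   ≈⟨ rhsFrom-cong m a s t (λ t′ t′≤t → ih (s≤s t′≤t) (ℕₚ.≤-trans t′≤t (ℕₚ.<⇒≤ t<T))) ⟩
        rhsFrom m a s Y t                 ≈⟨ Y-suc t m≤t t<T ⟨
        Y (suc t)                         ∎

  module Extension (m : ℕ) (a : Coeffs R) (s : ℤ) where

    -- back d q stands for V (s - d + q), the solution continued d steps backwards:
    -- V (s - d - 1) is found by solving the equation at s - d + m for its last
    -- term, whose coefficient (-1)^m is invertible.
    back : ℕ → ℕ → Carrier
    back zero    q       = solAt R m a s q
    back (suc d) zero    =
      sgn R m * (back d m - alternatingSum m (a (s ℤ.- + suc d ℤ.+ + suc m)) (back d) m)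
    back (suc d) (suc q) = back d q

    private
      back-suc-∸ : ∀ d {q j} → j ≤ q → back (suc d) (suc q ∸ j) ≡ back d (q ∸ j)
      back-suc-∸ d j≤q = ≡.cong (back (suc d)) (ℕₚ.+-∸-assoc 1 j≤q)

      S+x[x[B-S]]≈B : ∀ x S B → x * x ≈ 1# → S + x * (x * (B - S)) ≈ B
      S+x[x[B-S]]≈B x S B x²≈1 = begin
        S + x * (x * (B - S))   ≈⟨ +-congˡ (*-assoc x x _) ⟨
        S + x * x * (B - S)     ≈⟨ +-congˡ (≈-trans (*-congʳ x²≈1) (*-identityˡ _)) ⟩
        S + (B - S)             ≈⟨ +-comm S _ ⟩
        B - S + S               ≈⟨ +-assoc B (- S) S ⟩
        B + (- S + S)           ≈⟨ +-congˡ (-‿inverseˡ S) ⟩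
        B + 0#                  ≈⟨ +-identityʳ B ⟩
        B                       ∎

    back-suc : ∀ d {t} → m ≤ t → back d (suc t) ≈ rhsFrom m a (s ℤ.- + d) (back d) t
    back-suc zero {t} m≤t =
      ≈-trans (solAt-suc m a s m≤t) (reflexive (≡.cong (λ x → rhsFrom m a x (back 0) t) (≡.sym (ℤₚ.+-identityʳ s))))
    back-suc (suc d) m≤t with ℕₚ.m≤n⇒m<n∨m≡n m≤t
    ... | inj₂ refl = ≈-sym (begin
      alternatingSum m (a p) (back (suc d)) (suc m) + sgn R m * back (suc d) (m ∸ m)
        ≈⟨ +-cong (sum1-cong m (λ j _ j≤m → *-congˡ (*-congˡ (reflexive (back-suc-∸ d j≤m)))))
                  (*-congˡ (reflexive (≡.cong (back (suc d)) (ℕₚ.n∸n≡0 m)))) ⟩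
      S + sgn R m * (sgn R m * (back d m - S))
        ≈⟨ S+x[x[B-S]]≈B (sgn R m) S (back d m) (sgn*sgn≈1 m) ⟩
      back d m ∎)
      where
      p : ℤ
      p = s ℤ.- + suc d ℤ.+ + suc m
      S : Carrier
      S = alternatingSum m (a p) (back d) m
    ... | inj₁ (s≤s {n = t} m≤t′) = begin
      back d (suc t)                                      ≈⟨ back-suc d m≤t′ ⟩
      rhsFrom m a (s ℤ.- + d) (back d) t
        ≈⟨ +-cong (sum1-cong m (λ j _ j≤m → *-congˡ (*-cong
                     (reflexive (≡.cong (λ x → a x j) (x-[1+d]+[1+q]≡x-d+q s d (suc t))))
                     (reflexive (back-suc-∸ d (ℕₚ.≤-trans j≤m (ℕₚ.m≤n⇒m≤1+n m≤t′)))))))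
                  (*-congˡ (reflexive (back-suc-∸ d m≤t′))) ⟨
      rhsFrom m a (s ℤ.- + suc d) (back (suc d)) (suc t)  ∎

    private
      fromOffset : ℤ → Carrier
      fromOffset (+ q)     = back 0 q
      fromOffset -[1+ d ]  = back (suc d) 0

    extension : ℤ → Carrier
    extension z = fromOffset (z ℤ.- s)

    extension-back : ∀ d q → extension (s ℤ.- + d ℤ.+ + q) ≡ back d q
    extension-back zero    q       = ≡.cong fromOffset (cancel₀ s (+ q))
      where
      cancel₀ : ∀ s q → s ℤ.- + 0 ℤ.+ q ℤ.- s ≡ q
      cancel₀ = ℤ-Solver.solve-∀
    extension-back (suc d) zero    = ≡.cong fromOffset
      (≡.trans (≡.cong (λ y → s ℤ.- y ℤ.+ + 0 ℤ.- s) (ℤₚ.pos-+ 1 d))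
               (≡.trans (cancel₁ s (+ d)) (≡.cong ℤ.-_ (≡.sym (ℤₚ.pos-+ 1 d)))))
      where
      cancel₁ : ∀ s d → s ℤ.- (+ 1 ℤ.+ d) ℤ.+ + 0 ℤ.- s ≡ ℤ.- (+ 1 ℤ.+ d)
      cancel₁ = ℤ-Solver.solve-∀
    extension-back (suc d) (suc q) =
      ≡.trans (≡.cong extension (x-[1+d]+[1+q]≡x-d+q s d q)) (extension-back d q)

    extension-isSolution : IsSolution R m a extension
    extension-isSolution z with decompose-offset m s z
    ... | d , t , m≤t , refl = begin
      extension (s ℤ.- + d ℤ.+ + suc t)          ≡⟨ extension-back d (suc t) ⟩
      back d (suc t)                              ≈⟨ back-suc d m≤t ⟩
      rhsFrom m a (s ℤ.- + d) (back d) t          ≈⟨ rhs≈rhsFrom m a (s ℤ.- + d) extension (back d) t m≤t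
                                                       (λ q _ → reflexive (extension-back d q)) ⟨
      rhs R m a extension (s ℤ.- + d ℤ.+ + suc t) ∎

  module _ {m n : ℕ} {a : Coeffs R}
           (antiperiodic : ∀ V → IsSolution R m a V → ∀ i → V (i ℤ.+ + suc n) ≈ sgn R m * V i)
           (s : ℤ) where
    open Extension m a s

    solAt-antiperiodic : ∀ t → solAt R m a s (suc n ℕ.+ t) ≈ sgn R m * solAt R m a s t
    solAt-antiperiodic t = begin
      solAt R m a s (suc n ℕ.+ t)                   ≡⟨ extension-back 0 (suc n ℕ.+ t) ⟨
      extension (s ℤ.- + 0 ℤ.+ + (suc n ℕ.+ t))     ≡⟨ ≡.cong extension shift ⟩
      extension (s ℤ.- + 0 ℤ.+ + t ℤ.+ + suc n)     ≈⟨ antiperiodic extension extension-isSolution (s ℤ.- + 0 ℤ.+ + t) ⟩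
      sgn R m * extension (s ℤ.- + 0 ℤ.+ + t)       ≡⟨ ≡.cong (sgn R m *_) (extension-back 0 t) ⟩
      sgn R m * solAt R m a s t                     ∎
      where
      reorder : ∀ x n t → x ℤ.+ (n ℤ.+ t) ≡ x ℤ.+ t ℤ.+ n
      reorder = ℤ-Solver.solve-∀
      shift : s ℤ.- + 0 ℤ.+ + (suc n ℕ.+ t) ≡ s ℤ.- + 0 ℤ.+ + t ℤ.+ + suc n
      shift = ≡.trans (≡.cong (λ y → s ℤ.- + 0 ℤ.+ y) (ℤₚ.pos-+ (suc n) t)) (reorder (s ℤ.- + 0) (+ suc n) (+ t))

    solAt-pred-period : solAt R m a s n ≈ 1#
    solAt-pred-period = begin
      solAt R m a s n                               ≡⟨ extension-back 0 n ⟨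
      extension (s ℤ.- + 0 ℤ.+ + n)                 ≡⟨ ≡.cong extension shift ⟩
      extension (s ℤ.- + 1 ℤ.+ + 0 ℤ.+ + suc n)     ≈⟨ antiperiodic extension extension-isSolution (s ℤ.- + 1 ℤ.+ + 0) ⟩
      sgn R m * extension (s ℤ.- + 1 ℤ.+ + 0)       ≡⟨ ≡.cong (sgn R m *_) (extension-back 1 0) ⟩
      sgn R m * (sgn R m * (solAt R m a s m - S))   ≈⟨ *-congˡ (*-congˡ (+-cong (reflexive (solAt-m≡1 m a s)) (-‿cong S≈0))) ⟩
      sgn R m * (sgn R m * (1# - 0#))               ≈⟨ *-assoc _ _ _ ⟨
      sgn R m * sgn R m * (1# - 0#)                 ≈⟨ *-cong (sgn*sgn≈1 m) (≈-trans (+-congˡ -0#≈0#) (+-identityʳ 1#)) ⟩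
      1# * 1#                                       ≈⟨ *-identityˡ 1# ⟩
      1#                                            ∎
      where
      S : Carrier
      S = alternatingSum m (a (s ℤ.- + 1 ℤ.+ + suc m)) (solAt R m a s) m
      S≈0 : S ≈ 0#
      S≈0 = sum1-≈0 m (λ j 1≤j j≤m →
        ≈-trans (*-congˡ (≈-trans (*-congˡ (reflexive (solAt-< m a s (ℕₚ.∸-monoʳ-< {m} {j} {0} 1≤j j≤m)))) (zeroʳ _)))
                (zeroʳ _))
      reorder : ∀ s n → s ℤ.- + 0 ℤ.+ n ≡ s ℤ.- + 1 ℤ.+ + 0 ℤ.+ (+ 1 ℤ.+ n)
      reorder = ℤ-Solver.solve-∀
      shift : s ℤ.- + 0 ℤ.+ + n ≡ s ℤ.- + 1 ℤ.+ + 0 ℤ.+ + suc n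
      shift = ≡.trans (reorder s (+ n)) (≡.cong (λ y → s ℤ.- + 1 ℤ.+ + 0 ℤ.+ y) (≡.sym (ℤₚ.pos-+ 1 n)))

  -- Split the recurrence for F at n + cc at the term j = cc + 1: the terms before it
  -- vanish because F_n = … = F_{n+k-1} = 0, it equals ±b_{cc+1} because F_{n-1} = 1,
  -- and the terms after it form the sum below, up to the sign (-1)^{cc+1}.
  module _ {k w cc : ℕ} (F b : ℕ → Carrier) (cc<k : cc < k)
           (F-< : ∀ t → t < k → F t ≈ 0#)
           (F-pred-period : F (suc (k ℕ.+ w)) ≈ 1#)
           (F-period-< : ∀ t → t < k → F (suc (suc (k ℕ.+ w)) ℕ.+ t) ≈ 0#)
           (b-> : ∀ j → suc k < j → b j ≈ 0#)
           (F-rec : F (suc (suc (k ℕ.+ w)) ℕ.+ cc) ≈ alternatingSum (suc k) b F (suc (suc (k ℕ.+ w)) ℕ.+ cc))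
           where
    private
      N q C : ℕ
      N = suc (k ℕ.+ w)
      q = suc N ℕ.+ cc
      C = suc cc

      τ : ℕ → Carrier
      τ j = sgn R (j ∸ 1) * (b j * F (q ∸ j))

      g : ℕ → Carrier
      g j = sgn R (j ∸ 1) * (F (N ∸ j) * b (C ℕ.+ j))

      τ-head : sum1 R C τ ≈ sgn R cc * b C
      τ-head = begin
        sum1 R cc τ + sgn R cc * (b C * F (N ℕ.+ cc ∸ cc))
          ≈⟨ +-cong (sum1-≈0 cc τ≈0) (*-congˡ (*-congˡ (≈-trans (reflexive (≡.cong F (ℕₚ.m+n∸n≡m N cc))) F-pred-period))) ⟩
        0# + sgn R cc * (b C * 1#)    ≈⟨ +-identityˡ _ ⟩
        sgn R cc * (b C * 1#)         ≈⟨ *-congˡ (*-identityʳ _) ⟩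
        sgn R cc * b C                ∎
        where
        τ≈0 : ∀ j → 1 ≤ j → j ≤ cc → τ j ≈ 0#
        τ≈0 j _ j≤cc = ≈-trans (*-congˡ (≈-trans (*-congˡ (≈-trans
          (reflexive (≡.cong F (ℕₚ.+-∸-assoc (suc N) j≤cc)))
          (F-period-< (cc ∸ j) (ℕₚ.≤-<-trans (ℕₚ.m∸n≤m cc j) cc<k)))) (zeroʳ _))) (zeroʳ _)

      τ-tail : sum1 R N (λ j → τ (C ℕ.+ j)) ≈ sgn R C * sum1 R (suc w) g
      τ-tail = begin
        sum1 R N (λ j → τ (C ℕ.+ j))              ≈⟨ sum1-vanishing-tail _ (s≤s (ℕₚ.m≤n+m w k)) beyond-w ⟩
        sum1 R (suc w) (λ j → τ (C ℕ.+ j))        ≈⟨ sum1-cong (suc w) (λ j 1≤j _ → τ≈g j 1≤j) ⟩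
        sum1 R (suc w) (λ j → sgn R C * g j)      ≈⟨ sum1-*ˡ (suc w) (sgn R C) g ⟩
        sgn R C * sum1 R (suc w) g                ∎
        where
        F-at : ∀ j → F (q ∸ (C ℕ.+ j)) ≡ F (N ∸ j)
        F-at j = ≡.cong F ([n+c]∸[c+j]≡n∸j N cc j)
        beyond-w : ∀ j → suc w < j → j ≤ N → τ (C ℕ.+ j) ≈ 0#
        beyond-w j 1+w<j _ = ≈-trans (*-congˡ (≈-trans (*-congˡ (≈-trans (reflexive (F-at j))
          (F-< (N ∸ j) ([1+k+w]∸j<k (ℕₚ.≤-<-trans z≤n cc<k) 1+w<j)))) (zeroʳ _))) (zeroʳ _)
        τ≈g : ∀ j → 1 ≤ j → τ (C ℕ.+ j) ≈ sgn R C * g j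
        τ≈g (suc j) _ = begin
          sgn R (cc ℕ.+ suc j) * (b (C ℕ.+ suc j) * F (q ∸ (C ℕ.+ suc j)))
            ≈⟨ *-cong (≈-trans (reflexive (≡.cong (sgn R) (ℕₚ.+-suc cc j))) (sgn-+ C j))
                      (≈-trans (*-comm _ _) (*-congʳ (reflexive (F-at (suc j))))) ⟩
          sgn R C * sgn R j * (F (N ∸ suc j) * b (C ℕ.+ suc j))
            ≈⟨ *-assoc _ _ _ ⟩
          sgn R C * g (suc j) ∎

      balance : 0# ≈ sgn R cc * b C + sgn R C * sum1 R (suc w) g
      balance = begin
        0#                                                 ≈⟨ F-period-< cc cc<k ⟨
        F q                                                ≈⟨ F-rec ⟩
        sum1 R (suc k) τ                                   ≈⟨ sum1-vanishing-tail τ (ℕₚ.≤-trans (ℕₚ.m≤m+n (suc k) w) (ℕₚ.m≤n+m N C)) beyond-k ⟨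
        sum1 R (C ℕ.+ N) τ                                 ≈⟨ sum1-+ C N τ ⟩
        sum1 R C τ + sum1 R N (λ j → τ (C ℕ.+ j))          ≈⟨ +-cong τ-head τ-tail ⟩
        sgn R cc * b C + sgn R C * sum1 R (suc w) g        ∎
        where
        beyond-k : ∀ j → suc k < j → j ≤ C ℕ.+ N → τ j ≈ 0#
        beyond-k j k+1<j _ = ≈-trans (*-congˡ (≈-trans (*-congʳ (b-> j k+1<j)) (zeroˡ _))) (zeroʳ _)

    alternatingSum-across-period :
      sum1 R (suc w) (λ j → sgn R (j ∸ 1) * (F (suc (k ℕ.+ w) ∸ j) * b (suc cc ℕ.+ j))) ≈ b (suc cc)
    alternatingSum-across-period = ≈-sym (*-cancelˡ-involutive (sgn*sgn≈1 cc) (x∙y⁻¹≈ε⇒x≈y _ _ (begin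
      sgn R cc * b C - sgn R cc * G      ≈⟨ +-congˡ (-‿distribˡ-* (sgn R cc) G) ⟩
      sgn R cc * b C + sgn R C * G       ≈⟨ balance ⟨
      0#                                 ∎)))
      where
      G : Carrier
      G = sum1 R (suc w) g

  frieze-diagonal : ∀ m b x w j → j ≤ suc (m ℕ.+ w) →
    frieze R m b (x ℤ.+ + 1) (+ w ℤ.+ x ℤ.- + j ℤ.+ + 1) ≡ solAt R m b (x ℤ.- + m) (suc (m ℕ.+ w) ∸ j)
  frieze-diagonal m b x w j j≤ = ≡.trans
    (≡.cong (λ σ → solAt R m b σ ∣ + w ℤ.+ x ℤ.- + j ℤ.+ + 1 ℤ.- σ ∣) (x+1-[1+m]≡x-m x m))
    (≡.cong (λ z → solAt R m b (x ℤ.- + m) ∣ z ∣) (w+x-j+1-[x-m]≡+[1+m+w∸j] x m w j≤))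

  -- (c 1, …, c k, 1, 0, 0, …): the coefficients of an equation of order k + 1,
  -- including the coefficient 1 of its last term.
  extendedRow : ℕ → (ℕ → Carrier) → ℕ → Carrier
  extendedRow k c j with j ≤? k
  ... | yes _ = c j
  ... | no _ with j ℕ.≟ suc k
  ...   | yes _ = 1#
  ...   | no _  = 0#

  extendedRow-≤ : ∀ {k c j} → j ≤ k → extendedRow k c j ≡ c j
  extendedRow-≤ {k} {c} {j} j≤k with j ≤? k
  ... | yes _  = refl
  ... | no j≰k = contradiction j≤k j≰k

  extendedRow-suc : ∀ k c → extendedRow k c (suc k) ≡ 1#
  extendedRow-suc k c with suc k ≤? k
  ... | yes k<k = contradiction k<k (ℕₚ.<-irrefl refl)
  ... | no _ with suc k ℕ.≟ suc k
  ...   | yes _  = refl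
  ...   | no k≢k = contradiction refl k≢k

  extendedRow-> : ∀ {k c j} → suc k < j → extendedRow k c j ≡ 0#
  extendedRow-> {k} {c} {j} k+1<j with j ≤? k
  ... | yes j≤k = contradiction (ℕₚ.<-trans k+1<j (s≤s j≤k)) (ℕₚ.<-irrefl refl)
  ... | no _ with j ℕ.≟ suc k
  ...   | yes refl = contradiction k+1<j (ℕₚ.<-irrefl refl)
  ...   | no _     = refl

  module GaleDual {k w : ℕ} {a : Coeffs R} (inE : InE R k (suc (suc (k ℕ.+ w))) a) (i : ℤ) where
    private
      periodic : ∀ i j → 1 ≤ j → j ≤ k → a (i ℤ.+ + suc (suc (k ℕ.+ w))) j ≈ a i j
      periodic = proj₁ inE

      antiperiodic : ∀ V → IsSolution R k a V → ∀ i → V (i ℤ.+ + suc (suc (k ℕ.+ w))) ≈ sgn R k * V i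
      antiperiodic = proj₂ inE

      α : Coeffs R
      α = galeDual R k w a

      row : ℕ → Carrier
      row = extendedRow k (a i)

    expected : ℕ → Carrier
    expected t = row (suc (k ℕ.+ w) ∸ t)

    private
      module Step (u cc : ℕ) (1+u+cc≡k : suc (u ℕ.+ cc) ≡ k) where
        N : ℕ
        N = suc (k ℕ.+ w)

        p σ : ℤ
        p = i ℤ.- + w ℤ.+ + suc (w ℕ.+ u)
        σ = p ℤ.- + k

        F : ℕ → Carrier
        F = solAt R k a σ

        cc<k : cc < k
        cc<k = ≡.subst (cc <_) 1+u+cc≡k (s≤s (ℕₚ.m≤n+m cc u))

        F-< : ∀ t → t < k → F t ≈ 0#
        F-< t t<k = reflexive (solAt-< k a σ t<k)

        F-period-< : ∀ t → t < k → F (suc N ℕ.+ t) ≈ 0#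
        F-period-< t t<k = ≈-trans (solAt-antiperiodic antiperiodic σ t) (≈-trans (*-congˡ (F-< t t<k)) (zeroʳ _))

        F-rec : F (suc N ℕ.+ cc) ≈ alternatingSum (suc k) row F (suc N ℕ.+ cc)
        F-rec = ≈-trans (solAt-suc k a σ (ℕₚ.≤-trans (ℕₚ.m≤m+n k w) (ℕₚ.≤-trans (ℕₚ.n≤1+n _) (ℕₚ.m≤m+n N cc))))
          (+-cong (sum1-cong k (λ j 1≤j j≤k → *-congˡ (*-congʳ (begin
                     a (σ ℤ.+ + suc (N ℕ.+ cc)) j   ≡⟨ ≡.cong (λ x → a x j) (i-w+[1+w+u]-k+[2+k+w+c]≡i+[2+k+w] i w u cc 1+u+cc≡k) ⟩
                     a (i ℤ.+ + suc N) j            ≈⟨ periodic i j 1≤j j≤k ⟩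
                     a i j                          ≡⟨ extendedRow-≤ j≤k ⟨
                     row j                          ∎))))
                  (*-congˡ (≈-sym (≈-trans (*-congʳ (reflexive (extendedRow-suc k (a i)))) (*-identityˡ _)))))

        expected-at : ∀ {j} → j ≤ suc w → expected (suc (w ℕ.+ u) ∸ j) ≡ row (suc cc ℕ.+ j)
        expected-at j≤ = ≡.cong row ([1+k+w]∸[[1+w+u]∸j]≡1+c+j w u cc 1+u+cc≡k j≤)

        expected-suc : expected (suc (w ℕ.+ u)) ≈ rhsFrom w α (i ℤ.- + w) expected (w ℕ.+ u)
        expected-suc = ≈-sym (begin
          alternatingSum w (α p) expected (suc (w ℕ.+ u)) + sgn R w * expected (w ℕ.+ u ∸ w)
            ≈⟨ +-cong (sum1-cong w (λ j _ j≤w → *-congˡ (reflexive (≡.cong₂ _*_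
                         (frieze-diagonal k a p w j (ℕₚ.≤-trans j≤w (ℕₚ.≤-trans (ℕₚ.m≤n+m w k) (ℕₚ.n≤1+n _))))
                         (expected-at (ℕₚ.m≤n⇒m≤1+n j≤w))))))
                      (*-congˡ (≈-trans (reflexive (expected-at ℕₚ.≤-refl))
                                        (≈-sym (≈-trans (*-congʳ F[k]≈1) (*-identityˡ _))))) ⟩
          sum1 R (suc w) (λ j → sgn R (j ∸ 1) * (F (N ∸ j) * row (suc cc ℕ.+ j)))
            ≈⟨ alternatingSum-across-period F row cc<k F-< (solAt-pred-period antiperiodic σ) F-period-<
                 (λ j k+1<j → reflexive (extendedRow-> k+1<j)) F-rec ⟩
          row (suc cc)
            ≡⟨ ≡.trans (expected-at z≤n) (≡.cong row (ℕₚ.+-identityʳ (suc cc))) ⟨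
          expected (suc (w ℕ.+ u)) ∎)
          where
          F[k]≈1 : F (N ∸ suc w) ≈ 1#
          F[k]≈1 = reflexive (≡.trans (≡.cong F (ℕₚ.m+n∸n≡m k w)) (solAt-m≡1 k a σ))

    expected-dual-recurrence : ∀ t → w ≤ t → t < k ℕ.+ w → expected (suc t) ≈ rhsFrom w α (i ℤ.- + w) expected t
    expected-dual-recurrence t w≤t t<k+w with ℕₚ.m≤n⇒∃[o]m+o≡n w≤t
    ... | u , refl with ℕₚ.m≤n⇒∃[o]m+o≡n (ℕₚ.+-cancelʳ-< w u k (≡.subst (_< k ℕ.+ w) (ℕₚ.+-comm w u) t<k+w))
    ...   | cc , 1+u+cc≡k = Step.expected-suc u cc 1+u+cc≡k

    solAt-galeDual : ∀ t → t ≤ k ℕ.+ w → solAt R w α (i ℤ.- + w) t ≈ expected t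
    solAt-galeDual = solAt-unique w α (i ℤ.- + w) expected (k ℕ.+ w) expected-< expected-w expected-dual-recurrence
      where
      expected-< : ∀ t → t < w → expected t ≈ 0#
      expected-< t t<w = reflexive (extendedRow-> (ℕₚ.<-≤-trans (ℕₚ.m<m+n (suc k) (ℕₚ.m<n⇒0<n∸m t<w))
                                                   (ℕₚ.≤-reflexive (≡.sym (ℕₚ.+-∸-assoc (suc k) (ℕₚ.<⇒≤ t<w))))))
      expected-w : expected w ≈ 1#
      expected-w = reflexive (≡.trans (≡.cong row (ℕₚ.m+n∸n≡m (suc k) w)) (extendedRow-suc k (a i)))

open import Data.Nat using (_+_)

proposition4p3 : ∀ {c ℓ} (R : CommutativeRing c ℓ) → IsField R →
    (k n : ℕ) → 1 ≤ k → k + 2 ≤ n →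
    (a : Coeffs R) → InE R k n a →
    ∀ (i : ℤ) (j : ℕ) → 1 ≤ j → j ≤ k →
      CommutativeRing._≈_ R
        (frieze R (n ∸ (k + 2)) (galeDual R k (n ∸ (k + 2)) a)
          (i ℤ.+ + 1) (+ k ℤ.+ i ℤ.- + j ℤ.+ + 1))
        (a i j)
proposition4p3 R _ k n _ k+2≤n a inE i j 1≤j j≤k = begin
  frieze R w α (i ℤ.+ + 1) (+ k ℤ.+ i ℤ.- + j ℤ.+ + 1)
    ≡⟨ frieze-diagonal R w α i k j j≤1+w+k ⟩
  solAt R w α (i ℤ.- + w) (suc (w + k) ∸ j)
    ≡⟨ ≡.cong (λ m → solAt R w α (i ℤ.- + w) (suc m ∸ j)) (ℕₚ.+-comm w k) ⟩
  solAt R w α (i ℤ.- + w) (suc (k + w) ∸ j)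
    ≈⟨ GaleDual.solAt-galeDual R inE′ i (suc (k + w) ∸ j) (ℕₚ.∸-monoʳ-≤ (suc (k + w)) 1≤j) ⟩
  extendedRow R k (a i) (suc (k + w) ∸ (suc (k + w) ∸ j))
    ≡⟨ ≡.cong (extendedRow R k (a i)) (ℕₚ.m∸[m∸n]≡n j≤1+k+w) ⟩
  extendedRow R k (a i) j
    ≡⟨ extendedRow-≤ R j≤k ⟩
  a i j
    ∎
  where
  open CommutativeRing R using (setoid)
  open import Relation.Binary.Reasoning.Setoid setoid
  w : ℕ
  w = n ∸ (k + 2)
  α : Coeffs R
  α = galeDual R k w a
  j≤1+k+w : j ≤ suc (k + w)
  j≤1+k+w = ℕₚ.≤-trans j≤k (ℕₚ.≤-trans (ℕₚ.m≤m+n k w) (ℕₚ.n≤1+n _))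
  j≤1+w+k : j ≤ suc (w + k)
  j≤1+w+k = ℕₚ.≤-trans j≤k (ℕₚ.≤-trans (ℕₚ.m≤n+m k w) (ℕₚ.n≤1+n _))
  n≡2+k+w : n ≡ suc (suc (k + w))
  n≡2+k+w = ≡.trans (≡.sym (ℕₚ.m+[n∸m]≡n k+2≤n)) (regroup k w)
    where
    regroup : ∀ k w → k + 2 + w ≡ suc (suc (k + w))
    regroup = ℕ-Solver.solve-∀
  inE′ : InE R k (suc (suc (k + w))) a
  inE′ = ≡.subst (λ m → InE R k m a) n≡2+k+w inE
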